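{- Let $k\geq s\geq 2$. Every $k$-globally branch surviving Turing degree is also an $s$-globally branch surviving Turing degree.
   Context: A tree is a subset of $\omega^{<\omega}$ closed under initial segments. A $k$-branching tree is a tree in which every node has either exactly $1$ or exactly $k$ immediate successors. A function $g:\omega\to\omega$ is $k$-globally branch surviving if it is not a path through any computable $k$-branching tree; a Turing degree is $k$-globally branch surviving if it computes a $k$-globally branch surviving function. -}

module Defs where

open import Data.Nat using (ℕ; zero; suc; _+_; _<_)
open import Data.Fin using (Fin)
open import Data.Vec using (Vec; []; _∷_; lookup)
open import Data.List using (List; []; _∷_; _∷ʳ_; map; upTo; length)
open import Data.List.Membership.Propositional using (_∈_)
open import Data.List.Relation.Unary.Unique.Propositional using (Unique)
open import Data.Bool using (Bool; true; false; if_then_else_)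
open import Data.Product using (Σ; _×_; ∃)
open import Data.Sum using (_⊎_)
open import Relation.Binary.PropositionalEquality using (_≡_)
open import Relation.Nullary using (¬_)

-- Oracle partial recursive functions (Kleene's μ-recursive functions
-- with an oracle α : ℕ → ℕ), with a relational big-step semantics.

data Code : ℕ → Set where
  zer  : ∀ {n} → Code n
  succ : Code 1
  proj : ∀ {n} → Fin n → Code n
  orc  : Code 1
  comp : ∀ {n m} → Code m → Vec (Code n) m → Code n
  prim : ∀ {n} → Code n → Code (suc (suc n)) → Code (suc n)
  mu   : ∀ {n} → Code (suc n) → Code n

mutual
  data _⊢_[_]⇓_ (α : ℕ → ℕ) : ∀ {n} → Code n → Vec ℕ n → ℕ → Set where
    ev-zer  : ∀ {n} {xs : Vec ℕ n} → α ⊢ zer [ xs ]⇓ 0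
    ev-succ : ∀ {x} → α ⊢ succ [ x ∷ [] ]⇓ suc x
    ev-proj : ∀ {n} {i : Fin n} {xs} → α ⊢ proj i [ xs ]⇓ lookup xs i
    ev-orc  : ∀ {x} → α ⊢ orc [ x ∷ [] ]⇓ α x
    ev-comp : ∀ {n m} {f : Code m} {gs : Vec (Code n) m} {xs ys z} →
              α ⊢ gs [ xs ]⇓* ys → α ⊢ f [ ys ]⇓ z → α ⊢ comp f gs [ xs ]⇓ z
    ev-prim0 : ∀ {n} {g : Code n} {h xs y} →
               α ⊢ g [ xs ]⇓ y → α ⊢ prim g h [ 0 ∷ xs ]⇓ y
    ev-primS : ∀ {n} {g : Code n} {h xs m y z} →
               α ⊢ prim g h [ m ∷ xs ]⇓ y → α ⊢ h [ m ∷ y ∷ xs ]⇓ z →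
               α ⊢ prim g h [ suc m ∷ xs ]⇓ z
    ev-mu   : ∀ {n} {f : Code (suc n)} {xs m} →
              α ⊢ f [ m ∷ xs ]⇓ 0 →
              (∀ i → i < m → ∃ λ y → α ⊢ f [ i ∷ xs ]⇓ suc y) →
              α ⊢ mu f [ xs ]⇓ m

  data _⊢_[_]⇓*_ (α : ℕ → ℕ) {n} : ∀ {m} → Vec (Code n) m → Vec ℕ n → Vec ℕ m → Set where
    ev-[] : ∀ {xs} → α ⊢ [] [ xs ]⇓* []
    ev-∷  : ∀ {m} {g} {gs : Vec (Code n) m} {xs y ys} →
            α ⊢ g [ xs ]⇓ y → α ⊢ gs [ xs ]⇓* ys → α ⊢ (g ∷ gs) [ xs ]⇓* (y ∷ ys)

_≤T_ : (ℕ → ℕ) → (ℕ → ℕ) → Set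
h ≤T f = Σ (Code 1) λ e → ∀ x → f ⊢ e [ x ∷ [] ]⇓ h x

-- Coding of finite sequences ω^{<ω} as natural numbers (Cantor pairing)

tri : ℕ → ℕ
tri zero    = zero
tri (suc n) = suc n + tri n

pair : ℕ → ℕ → ℕ
pair x y = tri (x + y) + y

code : List ℕ → ℕ
code []       = 0
code (x ∷ xs) = suc (pair x (code xs))

-- Trees as (characteristic functions of) subsets of ω^{<ω}

IsTree : (List ℕ → Bool) → Set
IsTree t = ∀ σ n → t (σ ∷ʳ n) ≡ true → t σ ≡ true

-- computable (without oracle) via the coding of sequences
ComputableSet : (List ℕ → Bool) → Set
ComputableSet t = Σ (Code 1) λ e →
  ∀ σ → (λ _ → 0) ⊢ e [ code σ ∷ [] ]⇓ (if t σ then 1 else 0)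

KBranching : ℕ → (List ℕ → Bool) → Set
KBranching k t = ∀ σ → t σ ≡ true →
  Σ (List ℕ) λ L → Unique L × (length L ≡ 1 ⊎ length L ≡ k) ×
    (∀ n → (t (σ ∷ʳ n) ≡ true → n ∈ L) × (n ∈ L → t (σ ∷ʳ n) ≡ true))

IsPath : (List ℕ → Bool) → (ℕ → ℕ) → Set
IsPath t g = ∀ n → t (map g (upTo n)) ≡ true

GloballyBranchSurviving : ℕ → (ℕ → ℕ) → Set
GloballyBranchSurviving k g = ∀ (t : List ℕ → Bool) → IsTree t → KBranching k t →
  ComputableSet t → ¬ IsPath t g

DegreeGBS : ℕ → (ℕ → ℕ) → Set
DegreeGBS k f = Σ (ℕ → ℕ) λ g → g ≤T f × GloballyBranchSurviving k g

module Submission where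

-- Suppose g were a path through a computable s-branching tree t.  We widen t
-- to a computable k-branching tree t⁺ ⊇ t; then g is a path through t⁺,
-- contradicting that g is k-globally branch surviving.  Put d = k ∸ s.  Each
-- node σ ∈ t with s children, the largest being M, receives the d new
-- children M+1, …, M+d, and every new node is continued only by zeros.  So a
-- node of t⁺ outside t is σ ∷ʳ n followed by zeros, where n is the last
-- nonzero entry and a new child of σ; this description is decidable from t.

open import Defs
open import Data.Nat using (ℕ; zero; suc; _+_; _∸_; _≤_; _<_; z≤n; s≤s; pred; _≡ᵇ_; _<ᵇ_; _≤?_)
open import Data.Nat.Properties
open import Algebra.Properties.CommutativeSemigroup +-commutativeSemigroup
  using () renaming (interchange to +-interchange)
open import Data.Fin using (Fin; zero; suc; #_)
open import Data.Vec using (Vec; []; _∷_; lookup; tabulate)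
open import Data.Product using (Σ; _×_; _,_; proj₁; proj₂; ∃)
open import Relation.Binary.PropositionalEquality
open import Relation.Binary.Definitions using (tri<; tri≈; tri>)
open import Relation.Nullary using (¬_; yes; no)
open import Data.Empty using (⊥-elim)
open import Data.List using (List; []; _∷_; _++_; _∷ʳ_; length; applyUpTo; map; upTo)
open import Data.List.Properties using (length-++; length-applyUpTo; ++-identityʳ)
open import Data.List.Reverse using (Reverse; []; _∶_∶ʳ_; reverseView)
open import Data.List.Extrema.Nat using (max; argmax-sel; xs≤max)
open import Data.List.Membership.Propositional using (_∈_)
open import Data.List.Membership.Propositional.Properties using (∈-++⁺ˡ; ∈-++⁺ʳ; ∈-++⁻; ∈-applyUpTo⁺; ∈-applyUpTo⁻)
open import Data.List.Relation.Unary.Any using (here; there)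
import Data.List.Relation.Unary.All as All
open import Data.List.Relation.Unary.AllPairs using ([]; _∷_)
open import Data.List.Relation.Unary.Unique.Propositional using (Unique)
import Data.List.Relation.Unary.Unique.Propositional.Properties as UniqueP
open import Data.Bool using (Bool; true; false; if_then_else_; _∧_; _∨_; T)
open import Data.Bool.Properties using (∨-zeroʳ)
open import Data.Unit using (tt)
open import Data.Sum using (_⊎_; inj₁; inj₂)

-- Oracle-free computable functions

-- The constant zero oracle: a computation relative to it uses no oracle.
noOracle : ℕ → ℕ
noOracle _ = 0

Computable : ∀ n → (Vec ℕ n → ℕ) → Set
Computable n F = Σ (Code n) λ e → ∀ xs → noOracle ⊢ e [ xs ]⇓ F xs

fun₁ : (ℕ → ℕ) → Vec ℕ 1 → ℕ
fun₁ f (a ∷ []) = f a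

fun₂ : (ℕ → ℕ → ℕ) → Vec ℕ 2 → ℕ
fun₂ f (a ∷ b ∷ []) = f a b

fun₃ : (ℕ → ℕ → ℕ → ℕ) → Vec ℕ 3 → ℕ
fun₃ f (a ∷ b ∷ c ∷ []) = f a b c

fun₄ : (ℕ → ℕ → ℕ → ℕ → ℕ) → Vec ℕ 4 → ℕ
fun₄ f (a ∷ b ∷ c ∷ e ∷ []) = f a b c e

c-cong : ∀ {n} {F G : Vec ℕ n → ℕ} → (∀ xs → F xs ≡ G xs) → Computable n F → Computable n G
c-cong F≗G (e , run) = e , λ xs → subst (noOracle ⊢ e [ xs ]⇓_) (F≗G xs) (run xs)

c-zero : ∀ {n} → Computable n (λ _ → 0)
c-zero = zer , λ _ → ev-zer

c-suc : Computable 1 (fun₁ suc)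
c-suc = succ , λ { (x ∷ []) → ev-succ }

c-proj : ∀ {n} (i : Fin n) → Computable n (λ xs → lookup xs i)
c-proj i = proj i , λ _ → ev-proj

run-all : ∀ {n m} (es : Fin m → Code n) {xs} {ys : Fin m → ℕ} →
          (∀ i → noOracle ⊢ es i [ xs ]⇓ ys i) → noOracle ⊢ tabulate es [ xs ]⇓* tabulate ys
run-all {m = zero}  es runs = ev-[]
run-all {m = suc m} es runs = ev-∷ (runs zero) (run-all (λ i → es (suc i)) (λ i → runs (suc i)))

c-compose : ∀ {n m} {F : Vec ℕ m → ℕ} {G : Fin m → Vec ℕ n → ℕ} →
            Computable m F → (∀ i → Computable n (G i)) →
            Computable n (λ xs → F (tabulate λ i → G i xs))
c-compose (f , run) gs =
  comp f (tabulate λ i → proj₁ (gs i)) ,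
  λ xs → ev-comp (run-all _ λ i → proj₂ (gs i) xs) (run _)

c-compose₁ : ∀ {n} {F : Vec ℕ 1 → ℕ} {G₁ : Vec ℕ n → ℕ} →
             Computable 1 F → Computable n G₁ → Computable n (λ xs → F (G₁ xs ∷ []))
c-compose₁ {G₁ = G₁} f g₁ = c-compose {G = λ _ → G₁} f λ _ → g₁

c-compose₂ : ∀ {n} {F : Vec ℕ 2 → ℕ} {G₁ G₂ : Vec ℕ n → ℕ} →
             Computable 2 F → Computable n G₁ → Computable n G₂ →
             Computable n (λ xs → F (G₁ xs ∷ G₂ xs ∷ []))
c-compose₂ {G₁ = G₁} {G₂} f g₁ g₂ =
  c-compose {G = λ { zero → G₁ ; (suc _) → G₂ }} f λ { zero → g₁ ; (suc _) → g₂ }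

c-compose₃ : ∀ {n} {F : Vec ℕ 3 → ℕ} {G₁ G₂ G₃ : Vec ℕ n → ℕ} →
             Computable 3 F → Computable n G₁ → Computable n G₂ → Computable n G₃ →
             Computable n (λ xs → F (G₁ xs ∷ G₂ xs ∷ G₃ xs ∷ []))
c-compose₃ {G₁ = G₁} {G₂} {G₃} f g₁ g₂ g₃ =
  c-compose {G = λ { zero → G₁ ; (suc zero) → G₂ ; (suc (suc _)) → G₃ }} f
            λ { zero → g₁ ; (suc zero) → g₂ ; (suc (suc _)) → g₃ }

c-primRec : ∀ {n} {G : Vec ℕ n → ℕ} {H : Vec ℕ (suc (suc n)) → ℕ} (F : Vec ℕ (suc n) → ℕ) →
            Computable n G → Computable (suc (suc n)) H →
            (∀ xs → F (0 ∷ xs) ≡ G xs) →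
            (∀ m xs → F (suc m ∷ xs) ≡ H (m ∷ F (m ∷ xs) ∷ xs)) →
            Computable (suc n) F
c-primRec F (g , runG) (h , runH) F-zero F-suc = prim g h , λ { (m ∷ xs) → run m xs }
  where
  run : ∀ m xs → noOracle ⊢ prim g h [ m ∷ xs ]⇓ F (m ∷ xs)
  run zero    xs = subst (noOracle ⊢ prim g h [ 0 ∷ xs ]⇓_) (sym (F-zero xs)) (ev-prim0 (runG xs))
  run (suc m) xs = subst (noOracle ⊢ prim g h [ suc m ∷ xs ]⇓_) (sym (F-suc m xs))
                         (ev-primS (run m xs) (runH _))

c-μ : ∀ {n} {F : Vec ℕ (suc n) → ℕ} (W : Vec ℕ n → ℕ) → Computable (suc n) F →
      (∀ xs → F (W xs ∷ xs) ≡ 0) → (∀ xs i → i < W xs → ¬ F (i ∷ xs) ≡ 0) →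
      Computable n W
c-μ {F = F} W (f , run) root below =
  mu f , λ xs → ev-mu (subst (noOracle ⊢ f [ W xs ∷ xs ]⇓_) (root xs) (run _))
                      (λ i i<W → haltsNonzero (below xs i i<W) (run _))
  where
  haltsNonzero : ∀ {ys v} → ¬ v ≡ 0 → noOracle ⊢ f [ ys ]⇓ v → ∃ λ y → noOracle ⊢ f [ ys ]⇓ suc y
  haltsNonzero {v = zero}  v≢0 _   = ⊥-elim (v≢0 refl)
  haltsNonzero {v = suc y} _   run = y , run

c-const : ∀ {n} (c : ℕ) → Computable n (λ _ → c)
c-const zero    = c-zero
c-const (suc c) = c-compose₁ c-suc (c-const c)

c-+ : Computable 2 (fun₂ _+_)
c-+ = c-primRec (fun₂ _+_) (c-proj (# 0)) (c-compose₁ c-suc (c-proj (# 1)))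
        (λ { (b ∷ []) → refl }) (λ m → λ { (b ∷ []) → refl })

c-pred : Computable 1 (fun₁ pred)
c-pred = c-primRec (fun₁ pred) c-zero (c-proj (# 0)) (λ { [] → refl }) (λ m → λ { [] → refl })

-- Truncated subtraction is primitive recursive in the subtrahend.
c-∸ : Computable 2 (fun₂ _∸_)
c-∸ = c-cong (λ { (a ∷ b ∷ []) → refl })
        (c-compose₂ c-minus (c-proj (# 1)) (c-proj (# 0)))
  where
  minus : ℕ → ℕ → ℕ
  minus b a = a ∸ b
  c-minus : Computable 2 (fun₂ minus)
  c-minus = c-primRec (fun₂ minus) (c-proj (# 0)) (c-compose₁ c-pred (c-proj (# 1)))
              (λ { (a ∷ []) → refl }) (λ b → λ { (a ∷ []) → sym (pred[m∸n]≡m∸[1+n] a b) })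

c-tri : Computable 1 (fun₁ tri)
c-tri = c-primRec (fun₁ tri) c-zero (c-compose₂ c-+ (c-compose₁ c-suc (c-proj (# 0))) (c-proj (# 1)))
          (λ { [] → refl }) (λ m → λ { [] → refl })

c-pair : Computable 2 (fun₂ pair)
c-pair = c-cong (λ { (x ∷ y ∷ []) → refl })
           (c-compose₂ c-+ (c-compose₁ c-tri (c-compose₂ c-+ (c-proj (# 0)) (c-proj (# 1)))) (c-proj (# 1)))

ifZero : ℕ → ℕ → ℕ → ℕ
ifZero zero    b c = b
ifZero (suc _) b c = c

c-ifZero : Computable 3 (fun₃ ifZero)
c-ifZero = c-primRec (fun₃ ifZero) (c-proj (# 0)) (c-proj (# 3))
             (λ { (b ∷ c ∷ []) → refl }) (λ m → λ { (b ∷ c ∷ []) → refl })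

bit : Bool → ℕ
bit b = if b then 1 else 0

eqBit ltBit andBit : ℕ → ℕ → ℕ
eqBit  a b = ifZero ((a ∸ b) + (b ∸ a)) 1 0
ltBit  a b = ifZero (b ∸ a) 0 1
andBit a b = ifZero a 0 b

eqBit-correct : ∀ a b → eqBit a b ≡ bit (a ≡ᵇ b)
eqBit-correct zero    zero    = refl
eqBit-correct zero    (suc b) = refl
eqBit-correct (suc a) zero    = refl
eqBit-correct (suc a) (suc b) = eqBit-correct a b

ltBit-correct : ∀ a b → ltBit a b ≡ bit (a <ᵇ b)
ltBit-correct zero    zero    = refl
ltBit-correct zero    (suc b) = refl
ltBit-correct (suc a) zero    = refl
ltBit-correct (suc a) (suc b) = ltBit-correct a b

andBit-correct : ∀ x y → andBit (bit x) (bit y) ≡ bit (x ∧ y)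
andBit-correct false y = refl
andBit-correct true  y = refl

c-eqBit : Computable 2 (fun₂ eqBit)
c-eqBit = c-cong (λ { (a ∷ b ∷ []) → refl })
  (c-compose₃ c-ifZero
    (c-compose₂ c-+ (c-compose₂ c-∸ (c-proj (# 0)) (c-proj (# 1))) (c-compose₂ c-∸ (c-proj (# 1)) (c-proj (# 0))))
    (c-const 1) (c-const 0))

c-ltBit : Computable 2 (fun₂ ltBit)
c-ltBit = c-cong (λ { (a ∷ b ∷ []) → refl })
  (c-compose₃ c-ifZero (c-compose₂ c-∸ (c-proj (# 1)) (c-proj (# 0))) (c-const 0) (c-const 1))

c-andBit : Computable 2 (fun₂ andBit)
c-andBit = c-cong (λ { (a ∷ b ∷ []) → refl })
  (c-compose₃ c-ifZero (c-proj (# 0)) (c-const 0) (c-proj (# 1)))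

-- Inverting the Cantor pairing

next : ℕ × ℕ → ℕ × ℕ
next (zero  , y) = suc y , 0
next (suc x , y) = x , suc y

unpair : ℕ → ℕ × ℕ
unpair zero    = 0 , 0
unpair (suc d) = next (unpair d)

left right diagonal : ℕ → ℕ
left     d = proj₁ (unpair d)
right    d = proj₂ (unpair d)
diagonal d = left d + right d

pair-next : ∀ x y → pair (proj₁ (next (x , y))) (proj₂ (next (x , y))) ≡ suc (pair x y)
pair-next zero y = begin
    tri (suc y + 0) + 0 ≡⟨ +-identityʳ _ ⟩
    tri (suc y + 0)     ≡⟨ cong (λ z → tri (suc z)) (+-identityʳ y) ⟩
    suc (y + tri y)     ≡⟨ cong suc (+-comm y (tri y)) ⟩
    suc (tri y + y)     ∎
  where open ≡-Reasoning
pair-next (suc x) y = begin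
    tri (x + suc y) + suc y   ≡⟨ cong (λ z → tri z + suc y) (+-suc x y) ⟩
    tri (suc (x + y)) + suc y ≡⟨ +-suc _ y ⟩
    suc (tri (suc (x + y)) + y) ∎
  where open ≡-Reasoning

pair-unpair : ∀ d → pair (left d) (right d) ≡ d
pair-unpair zero    = refl
pair-unpair (suc d) = trans (pair-next (left d) (right d)) (cong suc (pair-unpair d))

diagonal-split : ∀ d → tri (diagonal d) + right d ≡ d
diagonal-split = pair-unpair

right≤diagonal : ∀ d → right d ≤ diagonal d
right≤diagonal d = m≤n+m (right d) (left d)

tri-mono : ∀ {m n} → m ≤ n → tri m ≤ tri n
tri-mono {zero}  z≤n       = z≤n
tri-mono {suc m} (s≤s m≤n) = +-mono-≤ (s≤s m≤n) (tri-mono m≤n)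

tri-split-< : ∀ {w y w′ y′} → y ≤ w → w < w′ → tri w + y < tri w′ + y′
tri-split-< {w} {y} {w′} {y′} y≤w w<w′ = begin-strict
    tri w + y  ≤⟨ +-monoʳ-≤ (tri w) y≤w ⟩
    tri w + w  <⟨ s≤s (≤-reflexive (+-comm (tri w) w)) ⟩
    tri (suc w) ≤⟨ tri-mono w<w′ ⟩
    tri w′     ≤⟨ m≤m+n (tri w′) y′ ⟩
    tri w′ + y′ ∎
  where open ≤-Reasoning

tri-split-injective : ∀ {w y w′ y′} → y ≤ w → y′ ≤ w′ → tri w + y ≡ tri w′ + y′ → w ≡ w′
tri-split-injective {w} {w′ = w′} y≤w y′≤w′ eq with <-cmp w w′
... | tri< w<w′ _ _ = ⊥-elim (<-irrefl eq (tri-split-< y≤w w<w′))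
... | tri≈ _ w≡w′ _ = w≡w′
... | tri> _ _ w>w′ = ⊥-elim (<-irrefl (sym eq) (tri-split-< y′≤w′ w>w′))

diagonal-pair : ∀ x y → diagonal (pair x y) ≡ x + y
diagonal-pair x y = tri-split-injective (right≤diagonal d) (m≤n+m y x) (diagonal-split d)
  where d = pair x y

right-pair : ∀ x y → right (pair x y) ≡ y
right-pair x y = +-cancelˡ-≡ (tri (x + y)) _ _
  (trans (cong (λ w → tri w + right (pair x y)) (sym (diagonal-pair x y))) (diagonal-split (pair x y)))

left-pair : ∀ x y → left (pair x y) ≡ x
left-pair x y = +-cancelʳ-≡ y _ _
  (trans (cong (left (pair x y) +_) (sym (right-pair x y))) (diagonal-pair x y))

-- The diagonal of d is the least w with d < tri (suc w).
c-diagonal : Computable 1 (fun₁ diagonal)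
c-diagonal = c-μ (fun₁ diagonal) c-test (λ { (d ∷ []) → root d }) (λ { (d ∷ []) i i<w → nonroot d i i<w })
  where
  c-test : Computable 2 (λ { (w ∷ d ∷ []) → suc d ∸ tri (suc w) })
  c-test = c-cong (λ { (w ∷ d ∷ []) → refl })
             (c-compose₂ c-∸ (c-compose₁ c-suc (c-proj (# 1))) (c-compose₁ c-tri (c-compose₁ c-suc (c-proj (# 0)))))
  root : ∀ d → suc d ∸ tri (suc (diagonal d)) ≡ 0
  root d = m≤n⇒m∸n≡0 (s≤s (begin
      d                               ≡⟨ sym (diagonal-split d) ⟩
      tri (diagonal d) + right d      ≤⟨ +-monoʳ-≤ (tri (diagonal d)) (right≤diagonal d) ⟩
      tri (diagonal d) + diagonal d   ≡⟨ +-comm (tri (diagonal d)) (diagonal d) ⟩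
      diagonal d + tri (diagonal d)   ∎))
    where open ≤-Reasoning
  nonroot : ∀ d i → i < diagonal d → ¬ suc d ∸ tri (suc i) ≡ 0
  nonroot d i i<w eq = <-irrefl (sym eq) (m<n⇒0<n∸m (s≤s (begin
      tri (suc i)                ≤⟨ tri-mono i<w ⟩
      tri (diagonal d)           ≤⟨ m≤m+n _ _ ⟩
      tri (diagonal d) + right d ≡⟨ diagonal-split d ⟩
      d                          ∎)))
    where open ≤-Reasoning

c-right : Computable 1 (fun₁ right)
c-right = c-cong (λ { (d ∷ []) → trans (cong (_∸ tri (diagonal d)) (sym (diagonal-split d)))
                                       (m+n∸m≡n (tri (diagonal d)) (right d)) })
            (c-compose₂ c-∸ (c-proj (# 0)) (c-compose₁ c-tri c-diagonal))

c-left : Computable 1 (fun₁ left)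
c-left = c-cong (λ { (d ∷ []) → m+n∸n≡m (left d) (right d) }) (c-compose₂ c-∸ c-diagonal c-right)

-- Codes of finite sequences

hd tl : ℕ → ℕ
hd c = left (pred c)
tl c = right (pred c)

hd-code : ∀ x xs → hd (code (x ∷ xs)) ≡ x
hd-code x xs = left-pair x (code xs)

tl-code : ∀ x xs → tl (code (x ∷ xs)) ≡ code xs
tl-code x xs = right-pair x (code xs)

tails : ℕ → ℕ → ℕ
tails zero    c = c
tails (suc i) c = tl (tails i c)

tails-suc : ∀ i c → tails (suc i) c ≡ tails i (tl c)
tails-suc zero    c = refl
tails-suc (suc i) c = cong tl (tails-suc i c)

tails-zero : ∀ i → tails i 0 ≡ 0
tails-zero zero    = refl
tails-zero (suc i) = cong tl (tails-zero i)

nth : ℕ → ℕ → ℕ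
nth c i = hd (tails i c)

c-nth : Computable 2 (fun₂ nth)
c-nth = c-cong (λ { (c ∷ i ∷ []) → refl })
          (c-compose₁ c-hd (c-compose₂ c-tails (c-proj (# 1)) (c-proj (# 0))))
  where
  c-hd : Computable 1 (fun₁ hd)
  c-hd = c-cong (λ { (c ∷ []) → refl }) (c-compose₁ c-left c-pred)
  c-tl : Computable 1 (fun₁ tl)
  c-tl = c-cong (λ { (c ∷ []) → refl }) (c-compose₁ c-right c-pred)
  c-tails : Computable 2 (fun₂ tails)
  c-tails = c-primRec (fun₂ tails) (c-proj (# 0)) (c-compose₁ c-tl (c-proj (# 1)))
              (λ { (c ∷ []) → refl }) (λ m → λ { (c ∷ []) → refl })

-- The i-th entry of a list, 0 beyond its end.
entry : List ℕ → ℕ → ℕ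
entry []       i       = 0
entry (x ∷ xs) zero    = x
entry (x ∷ xs) (suc i) = entry xs i

nth-code : ∀ σ i → nth (code σ) i ≡ entry σ i
nth-code []       zero    = refl
nth-code []       (suc i) = cong hd (tails-zero (suc i))
nth-code (x ∷ xs) zero    = hd-code x xs
nth-code (x ∷ xs) (suc i) = trans (cong hd (trans (tails-suc i _) (cong (tails i) (tl-code x xs))))
                                  (nth-code xs i)

entry-++ : ∀ σ τ i → i < length σ → entry (σ ++ τ) i ≡ entry σ i
entry-++ (x ∷ xs) τ zero    _         = refl
entry-++ (x ∷ xs) τ (suc i) (s≤s i<n) = entry-++ xs τ i i<n

entry-snoc : ∀ σ n → entry (σ ∷ʳ n) (length σ) ≡ n
entry-snoc []       n = refl
entry-snoc (x ∷ xs) n = entry-snoc xs n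

entry-beyond : ∀ σ i → length σ ≤ i → entry σ i ≡ 0
entry-beyond []       i       _         = refl
entry-beyond (x ∷ xs) (suc i) (s≤s n≤i) = entry-beyond xs i n≤i

length-snoc : ∀ (σ : List ℕ) n → length (σ ∷ʳ n) ≡ suc (length σ)
length-snoc σ n = trans (length-++ σ) (+-comm (length σ) 1)

length≤code : ∀ σ → length σ ≤ code σ
length≤code []       = z≤n
length≤code (x ∷ xs) = s≤s (≤-trans (length≤code xs) (m≤n+m (code xs) _))

-- Decoding, with fuel f bounding the length of the decoded list.
decodeWithin : ℕ → ℕ → List ℕ
decodeWithin zero    d       = []
decodeWithin (suc f) zero    = []
decodeWithin (suc f) (suc d) = left d ∷ decodeWithin f (right d)

-- Fuel d suffices to decode d, so code is a bijection between lists and ℕ.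
decode : ℕ → List ℕ
decode d = decodeWithin d d

-- Decoding the tail of a code needs no more fuel than the code itself.
right≤ : ∀ d → right d ≤ d
right≤ d = subst (right d ≤_) (diagonal-split d) (m≤n+m (right d) _)

code-decodeWithin : ∀ f d → d ≤ f → code (decodeWithin f d) ≡ d
code-decodeWithin zero    zero    _        = refl
code-decodeWithin (suc f) zero    _        = refl
code-decodeWithin (suc f) (suc d) (s≤s d≤f) = cong suc (trans
  (cong (pair (left d)) (code-decodeWithin f (right d) (≤-trans (right≤ d) d≤f)))
  (pair-unpair d))

decodeWithin-code : ∀ f σ → code σ ≤ f → decodeWithin f (code σ) ≡ σ
decodeWithin-code zero    []       _        = refl
decodeWithin-code (suc f) []       _        = refl
decodeWithin-code (suc f) (x ∷ xs) (s≤s c≤f) = cong₂ _∷_ (left-pair x (code xs))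
  (trans (cong (decodeWithin f) (right-pair x (code xs)))
         (decodeWithin-code f xs (≤-trans (m≤n+m (code xs) _) c≤f)))

code-decode : ∀ d → code (decode d) ≡ d
code-decode d = code-decodeWithin d d ≤-refl

decode-code : ∀ σ → decode (code σ) ≡ σ
decode-code σ = decodeWithin-code (code σ) σ ≤-refl

segment : (ℕ → ℕ) → ℕ → ℕ → List ℕ
segment a lo zero    = []
segment a lo (suc l) = a lo ∷ segment a (suc lo) l

segment-shift : ∀ a lo l → segment a (suc lo) l ≡ segment (λ i → a (suc i)) lo l
segment-shift a lo zero    = refl
segment-shift a lo (suc l) = cong (a (suc lo) ∷_) (segment-shift a (suc lo) l)

segment-cong : ∀ a b lo l → (∀ i → i < lo + l → a i ≡ b i) → segment a lo l ≡ segment b lo l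
segment-cong a b lo zero    a≗b = refl
segment-cong a b lo (suc l) a≗b =
  cong₂ _∷_ (a≗b lo (subst (lo <_) (sym (+-suc lo l)) (s≤s (m≤m+n lo l))))
            (segment-cong a b (suc lo) l λ i i< → a≗b i (subst (i <_) (sym (+-suc lo l)) i<))

segment-entry : ∀ σ τ → segment (entry (σ ++ τ)) 0 (length σ) ≡ σ
segment-entry []       τ = refl
segment-entry (x ∷ xs) τ = cong (x ∷_) (trans (segment-shift (entry (x ∷ xs ++ τ)) 0 (length xs))
                                              (segment-entry xs τ))

suffixCode : ℕ → ℕ → ℕ → ℕ → ℕ
suffixCode zero    c p m = suc (pair m 0)
suffixCode (suc j) c p m = suc (pair (nth c (p ∸ suc j)) (suffixCode j c p m))

suffixCode-correct : ∀ j c p m → j ≤ p → suffixCode j c p m ≡ code (segment (nth c) (p ∸ j) j ∷ʳ m)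
suffixCode-correct zero    c p m _   = refl
suffixCode-correct (suc j) c p m j<p = cong (λ z → suc (pair (nth c (p ∸ suc j)) z)) (trans
  (suffixCode-correct j c p m (≤-trans (n≤1+n j) j<p))
  (cong (λ lo → code (segment (nth c) lo j ∷ʳ m)) (+-∸-assoc 1 j<p)))

prefixCode : ℕ → ℕ → ℕ → ℕ
prefixCode c p m = suffixCode p c p m

prefixCode-correct : ∀ c p m → prefixCode c p m ≡ code (segment (nth c) 0 p ∷ʳ m)
prefixCode-correct c p m = trans (suffixCode-correct p c p m ≤-refl)
                                 (cong (λ lo → code (segment (nth c) lo p ∷ʳ m)) (n∸n≡0 p))

c-prefixCode : Computable 3 (fun₃ prefixCode)
c-prefixCode = c-cong (λ { (c ∷ p ∷ m ∷ []) → refl })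
                 (c-compose {G = λ i xs → lookup xs (argument i)} c-suffixCode (λ i → c-proj (argument i)))
  where
  -- suffixCode is applied to the arguments (p, c, p, m).
  argument : Fin 4 → Fin 3
  argument zero                   = # 1
  argument (suc zero)             = # 0
  argument (suc (suc zero))       = # 1
  argument (suc (suc (suc _)))    = # 2
  c-suffixCode : Computable 4 (fun₄ suffixCode)
  c-suffixCode = c-primRec (fun₄ suffixCode)
    (c-cong {G = λ { (c ∷ p ∷ m ∷ []) → suc (pair m 0) }} (λ { (c ∷ p ∷ m ∷ []) → refl })
      (c-compose₁ c-suc (c-compose₂ c-pair (c-proj (# 2)) c-zero)))
    (c-cong {G = λ { (j ∷ r ∷ c ∷ p ∷ m ∷ []) → suc (pair (nth c (p ∸ suc j)) r) }}
      (λ { (j ∷ r ∷ c ∷ p ∷ m ∷ []) → refl })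
      (c-compose₁ c-suc (c-compose₂ c-pair
        (c-compose₂ c-nth (c-proj (# 2)) (c-compose₂ c-∸ (c-proj (# 3)) (c-compose₁ c-suc (c-proj (# 0)))))
        (c-proj (# 1)))))
    (λ { (c ∷ p ∷ m ∷ []) → refl }) (λ j → λ { (c ∷ p ∷ m ∷ []) → refl })

-- One more than the position of the last nonzero value among a 0, …, a (i ∸ 1);
-- 0 if there is none.
lastNonzeroBelow : (ℕ → ℕ) → ℕ → ℕ
lastNonzeroBelow a zero    = 0
lastNonzeroBelow a (suc i) = ifZero (a i) (lastNonzeroBelow a i) (suc i)

lastNonzeroBelow-cong : ∀ a b i → (∀ j → j < i → a j ≡ b j) → lastNonzeroBelow a i ≡ lastNonzeroBelow b i
lastNonzeroBelow-cong a b zero    a≗b = refl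
lastNonzeroBelow-cong a b (suc i) a≗b = cong₂ (λ u v → ifZero u v (suc i)) (a≗b i ≤-refl)
  (lastNonzeroBelow-cong a b i λ j j<i → a≗b j (≤-trans j<i (n≤1+n i)))

lastNonzeroBelow-zeros : ∀ a l t → (∀ j → l ≤ j → a j ≡ 0) → lastNonzeroBelow a (l + t) ≡ lastNonzeroBelow a l
lastNonzeroBelow-zeros a l zero    zeros = cong (lastNonzeroBelow a) (+-identityʳ l)
lastNonzeroBelow-zeros a l (suc t) zeros = begin
    lastNonzeroBelow a (l + suc t)                            ≡⟨ cong (lastNonzeroBelow a) (+-suc l t) ⟩
    ifZero (a (l + t)) (lastNonzeroBelow a (l + t)) (suc (l + t)) ≡⟨ cong (λ u → ifZero u (lastNonzeroBelow a (l + t)) (suc (l + t))) (zeros (l + t) (m≤m+n l t)) ⟩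
    lastNonzeroBelow a (l + t)                                ≡⟨ lastNonzeroBelow-zeros a l t zeros ⟩
    lastNonzeroBelow a l                                      ∎
  where open ≡-Reasoning

lastNonzeroBelow≤ : ∀ a i → lastNonzeroBelow a i ≤ i
lastNonzeroBelow≤ a zero = z≤n
lastNonzeroBelow≤ a (suc i) with a i
... | zero  = ≤-trans (lastNonzeroBelow≤ a i) (n≤1+n i)
... | suc _ = ≤-refl

lastNonzero : List ℕ → ℕ
lastNonzero ρ = lastNonzeroBelow (entry ρ) (length ρ)

lastNonzeroCode : ℕ → ℕ
lastNonzeroCode c = lastNonzeroBelow (nth c) c

c-lastNonzeroCode : Computable 1 (fun₁ lastNonzeroCode)
c-lastNonzeroCode = c-cong (λ { (c ∷ []) → refl }) (c-compose₂ c-below (c-proj (# 0)) (c-proj (# 0)))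
  where
  c-below : Computable 2 (fun₂ λ i c → lastNonzeroBelow (nth c) i)
  c-below = c-primRec (fun₂ λ i c → lastNonzeroBelow (nth c) i) c-zero
    (c-cong {G = λ { (i ∷ r ∷ c ∷ []) → ifZero (nth c i) r (suc i) }} (λ { (i ∷ r ∷ c ∷ []) → refl })
      (c-compose₃ c-ifZero (c-compose₂ c-nth (c-proj (# 2)) (c-proj (# 0))) (c-proj (# 1)) (c-compose₁ c-suc (c-proj (# 0)))))
    (λ { (c ∷ []) → refl }) (λ i → λ { (c ∷ []) → refl })

-- Since a code bounds the length of its list, the code-level search sees all entries.
lastNonzero-code : ∀ ρ → lastNonzeroCode (code ρ) ≡ lastNonzero ρ
lastNonzero-code ρ = begin
    lastNonzeroBelow (nth (code ρ)) (code ρ)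
      ≡⟨ lastNonzeroBelow-cong _ (entry ρ) (code ρ) (λ j _ → nth-code ρ j) ⟩
    lastNonzeroBelow (entry ρ) (code ρ)
      ≡⟨ cong (lastNonzeroBelow (entry ρ)) (sym (m+[n∸m]≡n (length≤code ρ))) ⟩
    lastNonzeroBelow (entry ρ) (length ρ + (code ρ ∸ length ρ))
      ≡⟨ lastNonzeroBelow-zeros (entry ρ) (length ρ) _ (entry-beyond ρ) ⟩
    lastNonzero ρ ∎
  where open ≡-Reasoning

lastNonzero-snoc : ∀ σ n → lastNonzero (σ ∷ʳ n) ≡ ifZero n (lastNonzero σ) (suc (length σ))
lastNonzero-snoc σ n = trans (cong (lastNonzeroBelow (entry (σ ∷ʳ n))) (length-snoc σ n))
  (cong₂ (λ u v → ifZero u v (suc (length σ))) (entry-snoc σ n)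
         (lastNonzeroBelow-cong _ _ (length σ) (λ j j< → entry-++ σ (n ∷ []) j j<)))

lastNonzero≤length : ∀ σ → lastNonzero σ ≤ length σ
lastNonzero≤length σ = lastNonzeroBelow≤ (entry σ) (length σ)

T⇒true : ∀ {b} → T b → b ≡ true
T⇒true {true} _ = refl

true⇒T : ∀ {b} → b ≡ true → T b
true⇒T refl = tt

≡ᵇ-sound : ∀ {a b} → (a ≡ᵇ b) ≡ true → a ≡ b
≡ᵇ-sound {a} {b} e = ≡ᵇ⇒≡ a b (true⇒T e)

≡ᵇ-complete : ∀ {a b} → a ≡ b → (a ≡ᵇ b) ≡ true
≡ᵇ-complete {a} {b} e = T⇒true (≡⇒≡ᵇ a b e)

≡ᵇ-false : ∀ {a b} → ¬ a ≡ b → (a ≡ᵇ b) ≡ false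
≡ᵇ-false {a} {b} a≢b with a ≡ᵇ b in e
... | true  = ⊥-elim (a≢b (≡ᵇ-sound e))
... | false = refl

<ᵇ-sound : ∀ {a b} → (a <ᵇ b) ≡ true → a < b
<ᵇ-sound {a} {b} e = <ᵇ⇒< a b (true⇒T e)

<ᵇ-complete : ∀ {a b} → a < b → (a <ᵇ b) ≡ true
<ᵇ-complete a<b = T⇒true (<⇒<ᵇ a<b)

∧-true : ∀ {x y} → x ∧ y ≡ true → x ≡ true × y ≡ true
∧-true {true} {true} _ = refl , refl

∨-true : ∀ {x y} → x ∨ y ≡ true → x ≡ true ⊎ y ≡ true
∨-true {true}  _ = inj₁ refl
∨-true {false} e = inj₂ e

true≢false : ¬ true ≡ false
true≢false ()

countBelow : (ℕ → Bool) → ℕ → ℕ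
countBelow Q zero    = 0
countBelow Q (suc x) = countBelow Q x + bit (Q x)

countBelow-witness : ∀ Q x → ¬ countBelow Q x ≡ 0 → ∃ λ m → Q m ≡ true
countBelow-witness Q zero    c≢0 = ⊥-elim (c≢0 refl)
countBelow-witness Q (suc x) c≢0 with Q x in e
... | true  = x , e
... | false = countBelow-witness Q x (λ c≡0 → c≢0 (trans (+-identityʳ _) c≡0))

below occurrences : List ℕ → ℕ → ℕ
below       []      x = 0
below       (a ∷ L) x = bit (a <ᵇ x) + below L x
occurrences []      x = 0
occurrences (a ∷ L) x = bit (a ≡ᵇ x) + occurrences L x

below-zero : ∀ L → below L 0 ≡ 0
below-zero []      = refl
below-zero (a ∷ L) = below-zero L

below-suc : ∀ L x → below L (suc x) ≡ below L x + occurrences L x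
below-suc []      x = refl
below-suc (a ∷ L) x = begin
    bit (a <ᵇ suc x) + below L (suc x)
      ≡⟨ cong₂ _+_ (bit-<ᵇ-suc a x) (below-suc L x) ⟩
    (bit (a <ᵇ x) + bit (a ≡ᵇ x)) + (below L x + occurrences L x)
      ≡⟨ +-interchange (bit (a <ᵇ x)) (bit (a ≡ᵇ x)) (below L x) (occurrences L x) ⟩
    (bit (a <ᵇ x) + below L x) + (bit (a ≡ᵇ x) + occurrences L x) ∎
  where
  open ≡-Reasoning
  bit-<ᵇ-suc : ∀ a x → bit (a <ᵇ suc x) ≡ bit (a <ᵇ x) + bit (a ≡ᵇ x)
  bit-<ᵇ-suc zero    zero    = refl
  bit-<ᵇ-suc zero    (suc x) = refl
  bit-<ᵇ-suc (suc a) zero    = refl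
  bit-<ᵇ-suc (suc a) (suc x) = bit-<ᵇ-suc a x

occurrences-∉ : ∀ L x → ¬ x ∈ L → occurrences L x ≡ 0
occurrences-∉ []      x _   = refl
occurrences-∉ (a ∷ L) x x∉L = cong₂ _+_ (cong bit (≡ᵇ-false λ a≡x → x∉L (here (sym a≡x))))
                                        (occurrences-∉ L x (λ x∈L → x∉L (there x∈L)))

occurrences-∈ : ∀ L x → Unique L → x ∈ L → occurrences L x ≡ 1
occurrences-∈ (a ∷ L) x (a∉L ∷ uL) (here refl) =
  cong₂ _+_ (cong bit (≡ᵇ-complete {a} refl)) (occurrences-∉ L a λ a∈L → All.lookup a∉L a∈L refl)
occurrences-∈ (a ∷ L) x (a∉L ∷ uL) (there x∈L) =
  cong₂ _+_ (cong bit (≡ᵇ-false (All.lookup a∉L x∈L))) (occurrences-∈ L x uL x∈L)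

countBelow-list : ∀ Q L → Unique L → (∀ m → Q m ≡ true → m ∈ L) → (∀ m → m ∈ L → Q m ≡ true) →
                  ∀ x → countBelow Q x ≡ below L x
countBelow-list Q L uL Q⇒∈ ∈⇒Q zero    = sym (below-zero L)
countBelow-list Q L uL Q⇒∈ ∈⇒Q (suc x) =
  trans (cong₂ _+_ (countBelow-list Q L uL Q⇒∈ ∈⇒Q x) (indicator (Q x) refl)) (sym (below-suc L x))
  where
  indicator : ∀ b → Q x ≡ b → bit b ≡ occurrences L x
  indicator true  Qx = sym (occurrences-∈ L x uL (Q⇒∈ x Qx))
  indicator false Qx = sym (occurrences-∉ L x λ x∈L → true≢false (trans (sym (∈⇒Q x x∈L)) Qx))

below≤length : ∀ L x → below L x ≤ length L
below≤length []      x = z≤n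
below≤length (a ∷ L) x = +-mono-≤ (bit≤1 (a <ᵇ x)) (below≤length L x)
  where
  bit≤1 : ∀ b → bit b ≤ 1
  bit≤1 true  = ≤-refl
  bit≤1 false = z≤n

below-all : ∀ L x → (∀ m → m ∈ L → m < x) → below L x ≡ length L
below-all []      x all< = refl
below-all (a ∷ L) x all< = cong₂ _+_ (cong bit (<ᵇ-complete (all< a (here refl))))
                                     (below-all L x λ m m∈L → all< m (there m∈L))

below-full : ∀ L x → below L x ≡ length L → ∀ m → m ∈ L → m < x
below-full (a ∷ L) x full m m∈ with a <ᵇ x in a<x
below-full (a ∷ L) x full m (here refl) | true = <ᵇ-sound a<x
below-full (a ∷ L) x full m (there m∈L) | true = below-full L x (suc-injective full) m m∈L
below-full (a ∷ L) x full m m∈          | false = ⊥-elim (<-irrefl full (s≤s (below≤length L x)))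

Enumerates : (ℕ → Bool) → List ℕ → Set
Enumerates P L = ∀ n → (P n ≡ true → n ∈ L) × (n ∈ L → P n ≡ true)

enumerates-cong : ∀ {P Q L} → (∀ n → P n ≡ Q n) → Enumerates P L → Enumerates Q L
enumerates-cong P≗Q enum n = (λ Qn → proj₁ (enum n) (trans (P≗Q n) Qn)) ,
                             (λ n∈L → trans (sym (P≗Q n)) (proj₂ (enum n) n∈L))

enumerates-∨ : ∀ {P Q L L′} → Enumerates P L → Enumerates Q L′ → Enumerates (λ n → P n ∨ Q n) (L ++ L′)
enumerates-∨ {P} {Q} {L} {L′} enumP enumQ n = to , from
  where
  to : P n ∨ Q n ≡ true → n ∈ L ++ L′
  to PQn with ∨-true PQn
  ... | inj₁ Pn = ∈-++⁺ˡ (proj₁ (enumP n) Pn)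
  ... | inj₂ Qn = ∈-++⁺ʳ L (proj₁ (enumQ n) Qn)
  from : n ∈ L ++ L′ → P n ∨ Q n ≡ true
  from n∈ with ∈-++⁻ L n∈
  ... | inj₁ n∈L  = cong (_∨ Q n) (proj₂ (enumP n) n∈L)
  ... | inj₂ n∈L′ = trans (cong (P n ∨_) (proj₂ (enumQ n) n∈L′)) (∨-zeroʳ (P n))

interval : ℕ → ℕ → List ℕ
interval a d = applyUpTo (a +_) d

∈-interval⁺ : ∀ a d n → a ≤ n → n < a + d → n ∈ interval a d
∈-interval⁺ a d n a≤n n<a+d = subst (_∈ interval a d) (m+[n∸m]≡n a≤n)
  (∈-applyUpTo⁺ (a +_) (+-cancelˡ-< a (n ∸ a) d (subst (_< a + d) (sym (m+[n∸m]≡n a≤n)) n<a+d)))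

∈-interval⁻ : ∀ a d n → n ∈ interval a d → a ≤ n × n < a + d
∈-interval⁻ a d n n∈ with ∈-applyUpTo⁻ (a +_) n∈
... | i , i<d , refl = m≤m+n a i , +-monoʳ-< a i<d

interval-unique : ∀ a d → Unique (interval a d)
interval-unique a d = UniqueP.applyUpTo⁺₁ (a +_) d λ i<j _ eq → <⇒≢ i<j (+-cancelˡ-≡ a _ _ eq)

max-∈ : ∀ L → 0 < length L → max 0 L ∈ L
max-∈ (a ∷ L) _ with argmax-sel (λ x → x) 0 (a ∷ L)
... | inj₂ M∈ = M∈
... | inj₁ M≡0 = here (trans M≡0 (sym (n≤0⇒n≡0 (subst (a ≤_) M≡0 (All.head (xs≤max 0 (a ∷ L)))))))

≤-max : ∀ L m → m ∈ L → m ≤ max 0 L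
≤-max L m m∈L = All.lookup (xs≤max 0 L) m∈L

-- Widening a tree by d extra children per full node

module Widening (t : List ℕ → Bool) (s d : ℕ) where

  childrenBelow : List ℕ → ℕ → ℕ
  childrenBelow σ = countBelow (λ m → t (σ ∷ʳ m))

  -- n is one of the children added to σ: all s children of σ lie below n,
  -- but not all of them lie below n ∸ d.
  isNew : List ℕ → ℕ → Bool
  isNew σ n = (childrenBelow σ n ≡ᵇ s) ∧ (childrenBelow σ (n ∸ d) <ᵇ s)

  -- Whether ρ is a new child followed by zeros, given that entry r of ρ is
  -- its last nonzero entry (the argument is suc r; 0 when ρ is all zeros).
  isNewAt : List ℕ → ℕ → Bool
  isNewAt ρ zero    = false
  isNewAt ρ (suc r) = isNew (segment (entry ρ) 0 r) (entry ρ r)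

  added : List ℕ → Bool
  added ρ = isNewAt ρ (lastNonzero ρ)

  widen : List ℕ → Bool
  widen ρ = t ρ ∨ added ρ

  widen-path : ∀ g → IsPath t g → IsPath widen g
  widen-path g path n = cong (_∨ added (map g (upTo n))) (path n)

  added-snoc-suc : ∀ σ n → added (σ ∷ʳ suc n) ≡ isNew σ (suc n)
  added-snoc-suc σ n = begin
      isNewAt (σ ∷ʳ suc n) (lastNonzero (σ ∷ʳ suc n))
        ≡⟨ cong (isNewAt (σ ∷ʳ suc n)) (lastNonzero-snoc σ (suc n)) ⟩
      isNew (segment (entry (σ ∷ʳ suc n)) 0 (length σ)) (entry (σ ∷ʳ suc n) (length σ))
        ≡⟨ cong₂ isNew (segment-entry σ (suc n ∷ [])) (entry-snoc σ (suc n)) ⟩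
      isNew σ (suc n) ∎
    where open ≡-Reasoning

  added-snoc-zero : ∀ σ → added (σ ∷ʳ 0) ≡ added σ
  added-snoc-zero σ = trans (cong (isNewAt (σ ∷ʳ 0)) (lastNonzero-snoc σ 0))
                            (isNewAt-snoc-zero (lastNonzero σ) (lastNonzero≤length σ))
    where
    isNewAt-snoc-zero : ∀ r → r ≤ length σ → isNewAt (σ ∷ʳ 0) r ≡ isNewAt σ r
    isNewAt-snoc-zero zero    _   = refl
    isNewAt-snoc-zero (suc r) r<n = cong₂ isNew
      (segment-cong _ _ 0 r λ i i<r → entry-++ σ (0 ∷ []) i (≤-trans i<r (≤-trans (n≤1+n r) r<n)))
      (entry-++ σ (0 ∷ []) r r<n)

  module _ (2≤s : 2 ≤ s) (isTree : IsTree t) (branching : KBranching s t) where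

    isNew-zero : ∀ σ → isNew σ 0 ≡ false
    isNew-zero σ = cong (_∧ (childrenBelow σ (0 ∸ d) <ᵇ s)) (≡ᵇ-false λ 0≡s → <-irrefl 0≡s (≤-trans (s≤s z≤n) 2≤s))

    isNew-parent : ∀ σ n → isNew σ n ≡ true → t σ ≡ true
    isNew-parent σ n new with countBelow-witness (λ m → t (σ ∷ʳ m)) n
      (λ none → <-irrefl (trans (sym none) (≡ᵇ-sound (proj₁ (∧-true new)))) (≤-trans (s≤s z≤n) 2≤s))
    ... | m , child = isTree σ m child

    module Node (σ : List ℕ) (tσ : t σ ≡ true) where

      L : List ℕ
      L = proj₁ (branching σ tσ)

      L-unique : Unique L
      L-unique = proj₁ (proj₂ (branching σ tσ))

      L-length : length L ≡ 1 ⊎ length L ≡ s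
      L-length = proj₁ (proj₂ (proj₂ (branching σ tσ)))

      L-children : Enumerates (λ m → t (σ ∷ʳ m)) L
      L-children = proj₂ (proj₂ (proj₂ (branching σ tσ)))

      childrenBelow-L : ∀ x → childrenBelow σ x ≡ below L x
      childrenBelow-L = countBelow-list (λ m → t (σ ∷ʳ m)) L L-unique
                          (λ m → proj₁ (L-children m)) (λ m → proj₂ (L-children m))

      all-below : ∀ n → childrenBelow σ n ≡ s → length L ≡ s × (∀ m → m ∈ L → m < n)
      all-below n count with L-length
      ... | inj₁ one  = ⊥-elim (<-irrefl refl (≤-trans 2≤s (begin
            s                 ≡⟨ sym count ⟩
            childrenBelow σ n ≡⟨ childrenBelow-L n ⟩
            below L n         ≤⟨ below≤length L n ⟩
            length L          ≡⟨ one ⟩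
            1                 ∎)))
        where open ≤-Reasoning
      ... | inj₂ full = full , below-full L n (trans (sym (childrenBelow-L n)) (trans count (sym full)))

      isNew-child : ∀ n → t (σ ∷ʳ n) ≡ true → isNew σ n ≡ false
      isNew-child n child with isNew σ n in new
      ... | false = refl
      ... | true  = ⊥-elim (<-irrefl refl
              (proj₂ (all-below n (≡ᵇ-sound (proj₁ (∧-true new)))) n (proj₁ (L-children n) child)))

      new-none : length L ≡ 1 → Enumerates (isNew σ) []
      new-none one n = (λ new → ⊥-elim (<-irrefl refl (≤-trans 2≤s (≤-reflexive
                          (trans (sym (proj₁ (all-below n (≡ᵇ-sound (proj₁ (∧-true new)))))) one))))) ,
                       λ ()

      module Full (full : length L ≡ s) where

        M : ℕ
        M = max 0 L

        M∈L : M ∈ L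
        M∈L = max-∈ L (subst (0 <_) (sym full) (≤-trans (s≤s z≤n) 2≤s))

        count-s : ∀ x → M < x → childrenBelow σ x ≡ s
        count-s x M<x = trans (childrenBelow-L x)
          (trans (below-all L x λ m m∈L → ≤-<-trans (≤-max L m m∈L) M<x) full)

        count<s : ∀ x → x ≤ M → childrenBelow σ x < s
        count<s x x≤M = subst (_< s) (sym (childrenBelow-L x)) (subst (below L x <_) full
          (≤∧≢⇒< (below≤length L x) λ all → <-irrefl refl (≤-trans (below-full L x all M M∈L) x≤M)))

        new⇒interval : ∀ n → isNew σ n ≡ true → suc M ≤ n × n < suc M + d
        new⇒interval n new = proj₂ (all-below n (≡ᵇ-sound (proj₁ (∧-true new)))) M M∈L , s≤s n≤M+d
          where
          n≤M+d : n ≤ M + d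
          n≤M+d with n ≤? M + d
          ... | yes n≤ = n≤
          ... | no  n≰ = ⊥-elim (<-irrefl (count-s (n ∸ d) M<n∸d) (<ᵇ-sound (proj₂ (∧-true new))))
            where
            M<n∸d : M < n ∸ d
            M<n∸d = ≤-trans (≤-reflexive (sym (m+n∸n≡m (suc M) d))) (∸-monoˡ-≤ d (≰⇒> n≰))

        interval⇒new : ∀ n → suc M ≤ n → n < suc M + d → isNew σ n ≡ true
        interval⇒new n M<n n<M+d = cong₂ _∧_ (≡ᵇ-complete (count-s n M<n))
          (<ᵇ-complete (count<s (n ∸ d) (m≤n+o⇒m∸n≤o n d (subst (n ≤_) (+-comm M d) (≤-pred n<M+d)))))

        new-interval : Enumerates (isNew σ) (interval (suc M) d)
        new-interval n = (λ new → ∈-interval⁺ (suc M) d n (proj₁ (new⇒interval n new)) (proj₂ (new⇒interval n new))) ,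
                         (λ n∈ → interval⇒new n (proj₁ (∈-interval⁻ (suc M) d n n∈)) (proj₂ (∈-interval⁻ (suc M) d n n∈)))

        old-new-disjoint : ∀ {n} → ¬ (n ∈ L × n ∈ interval (suc M) d)
        old-new-disjoint (n∈L , n∈I) = <-irrefl refl (≤-trans (proj₁ (∈-interval⁻ (suc M) d _ n∈I)) (≤-max L _ n∈L))

    added-outside : ∀ ρ → t ρ ≡ true → added ρ ≡ false
    added-outside ρ = go (reverseView ρ)
      where
      go : ∀ {ρ} → Reverse ρ → t ρ ≡ true → added ρ ≡ false
      go []                  _  = refl
      go (σ ∶ rσ ∶ʳ zero)    tρ = trans (added-snoc-zero σ) (go rσ (isTree σ 0 tρ))
      go (σ ∶ rσ ∶ʳ suc n)   tρ = trans (added-snoc-suc σ n)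
                                        (Node.isNew-child σ (isTree σ (suc n) tρ) (suc n) tρ)

    widen-tree : IsTree widen
    widen-tree σ n wσn with ∨-true wσn
    widen-tree σ n       _ | inj₁ tσn = cong (_∨ added σ) (isTree σ n tσn)
    widen-tree σ zero    _ | inj₂ aσ0 =
      trans (cong (t σ ∨_) (trans (sym (added-snoc-zero σ)) aσ0)) (∨-zeroʳ (t σ))
    widen-tree σ (suc n) _ | inj₂ aσn =
      cong (_∨ added σ) (isNew-parent σ (suc n) (trans (sym (added-snoc-suc σ n)) aσn))

    children-inside : ∀ σ → t σ ≡ true → ∀ n → t (σ ∷ʳ n) ∨ isNew σ n ≡ widen (σ ∷ʳ n)
    children-inside σ tσ zero    = cong (t (σ ∷ʳ 0) ∨_)
      (trans (isNew-zero σ) (sym (trans (added-snoc-zero σ) (added-outside σ tσ))))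
    children-inside σ tσ (suc n) = cong (t (σ ∷ʳ suc n) ∨_) (sym (added-snoc-suc σ n))

    children-added : ∀ σ → t σ ≡ false → added σ ≡ true → Enumerates (λ n → widen (σ ∷ʳ n)) (0 ∷ [])
    children-added σ tσ aσ n = to n , from
      where
      not-in-t : ¬ t σ ≡ true
      not-in-t tσ′ = true≢false (trans (sym tσ′) tσ)
      to : ∀ n → widen (σ ∷ʳ n) ≡ true → n ∈ 0 ∷ []
      to n wσn with ∨-true wσn
      to n       _ | inj₁ child = ⊥-elim (not-in-t (isTree σ n child))
      to zero    _ | inj₂ _     = here refl
      to (suc n) _ | inj₂ aσn   =
        ⊥-elim (not-in-t (isNew-parent σ (suc n) (trans (sym (added-snoc-suc σ n)) aσn)))
      from : n ∈ 0 ∷ [] → widen (σ ∷ʳ n) ≡ true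
      from (here refl) = trans (cong (t (σ ∷ʳ 0) ∨_) (trans (added-snoc-zero σ) aσ)) (∨-zeroʳ _)

    -- The widening is (s + d)-branching: an added node has one child, a node of
    -- t with one child keeps it, and a full node gets s + d children.
    widen-branching : ∀ k → s + d ≡ k → KBranching k widen
    widen-branching k s+d≡k σ wσ with t σ in tσ
    ... | false = (0 ∷ []) , (All.[] ∷ []) , inj₁ refl , children-added σ tσ wσ
    ... | true  = by-length L-length
      where
      open Node σ tσ
      by-length : length L ≡ 1 ⊎ length L ≡ s → Σ (List ℕ) λ L′ →
                  Unique L′ × (length L′ ≡ 1 ⊎ length L′ ≡ k) × Enumerates (λ n → widen (σ ∷ʳ n)) L′
      by-length (inj₁ one)  =
        L ++ [] , UniqueP.++⁺ L-unique [] (λ ()) , inj₁ (trans (cong length (++-identityʳ L)) one) ,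
        enumerates-cong (children-inside σ tσ) (enumerates-∨ L-children (new-none one))
      by-length (inj₂ full) =
        L ++ interval (suc M) d , UniqueP.++⁺ L-unique (interval-unique (suc M) d) old-new-disjoint ,
        inj₂ (trans (length-++ L) (trans (cong₂ _+_ full (length-applyUpTo (suc M +_) d)) s+d≡k)) ,
        enumerates-cong (children-inside σ tσ) (enumerates-∨ L-children new-interval)
        where open Full full

  -- If t is computable, so is its widening: each test above is carried out
  -- on codes by a program that agrees with it on every code.
  module _ (t-computable : ComputableSet t) where

    tCode : ℕ → ℕ
    tCode c = bit (t (decode c))

    tCode-code : ∀ τ → tCode (code τ) ≡ bit (t τ)
    tCode-code τ = cong (λ τ′ → bit (t τ′)) (decode-code τ)

    c-tCode : Computable 1 (fun₁ tCode)
    c-tCode = e , λ { (c ∷ []) → subst (λ c′ → noOracle ⊢ e [ c′ ∷ [] ]⇓ tCode c) (code-decode c) (run (decode c)) }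
      where
      e = proj₁ t-computable
      run = proj₂ t-computable

    childrenBelowCode : ℕ → ℕ → ℕ → ℕ
    childrenBelowCode zero    c r = 0
    childrenBelowCode (suc x) c r = childrenBelowCode x c r + tCode (prefixCode c r x)

    c-childrenBelowCode : Computable 3 (fun₃ childrenBelowCode)
    c-childrenBelowCode = c-primRec (fun₃ childrenBelowCode) c-zero
      (c-cong {G = λ { (x ∷ v ∷ c ∷ r ∷ []) → v + tCode (prefixCode c r x) }} (λ { (x ∷ v ∷ c ∷ r ∷ []) → refl })
        (c-compose₂ c-+ (c-proj (# 1)) (c-compose₁ c-tCode (c-compose₃ c-prefixCode (c-proj (# 2)) (c-proj (# 3)) (c-proj (# 0))))))
      (λ { (c ∷ r ∷ []) → refl }) (λ x → λ { (c ∷ r ∷ []) → refl })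

    childrenBelowCode-correct : ∀ x ρ r → childrenBelowCode x (code ρ) r ≡ childrenBelow (segment (entry ρ) 0 r) x
    childrenBelowCode-correct zero    ρ r = refl
    childrenBelowCode-correct (suc x) ρ r = cong₂ _+_ (childrenBelowCode-correct x ρ r) (begin
        tCode (prefixCode (code ρ) r x)                ≡⟨ cong tCode (prefixCode-correct (code ρ) r x) ⟩
        tCode (code (segment (nth (code ρ)) 0 r ∷ʳ x)) ≡⟨ cong (λ σ → tCode (code (σ ∷ʳ x)))
                                                              (segment-cong _ _ 0 r λ i _ → nth-code ρ i) ⟩
        tCode (code (segment (entry ρ) 0 r ∷ʳ x))      ≡⟨ tCode-code _ ⟩
        bit (t (segment (entry ρ) 0 r ∷ʳ x))           ∎)
      where open ≡-Reasoning

    isNewAtCode : ℕ → ℕ → ℕ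
    isNewAtCode c zero    = 0
    isNewAtCode c (suc r) = andBit (eqBit (childrenBelowCode (nth c r) c r) s)
                                   (ltBit (childrenBelowCode (nth c r ∸ d) c r) s)

    c-isNewAtCode : Computable 2 (fun₂ isNewAtCode)
    c-isNewAtCode = c-cong (λ { (c ∷ zero ∷ []) → refl ; (c ∷ suc r ∷ []) → refl })
      (c-compose₃ c-ifZero (c-proj (# 1)) c-zero
        (c-compose₂ c-andBit
          (c-compose₂ c-eqBit (c-compose₃ c-childrenBelowCode c-entry (c-proj (# 0)) c-r) (c-const s))
          (c-compose₂ c-ltBit (c-compose₃ c-childrenBelowCode (c-compose₂ c-∸ c-entry (c-const d)) (c-proj (# 0)) c-r)
                              (c-const s))))
      where
      -- r = pred q is the position of the last nonzero entry, and nth c r that entry.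
      c-r : Computable 2 (fun₂ λ c q → pred q)
      c-r = c-cong (λ { (c ∷ q ∷ []) → refl }) (c-compose₁ c-pred (c-proj (# 1)))
      c-entry : Computable 2 (fun₂ λ c q → nth c (pred q))
      c-entry = c-cong (λ { (c ∷ q ∷ []) → refl }) (c-compose₂ c-nth (c-proj (# 0)) c-r)

    isNewAtCode-correct : ∀ ρ q → isNewAtCode (code ρ) q ≡ bit (isNewAt ρ q)
    isNewAtCode-correct ρ zero    = refl
    isNewAtCode-correct ρ (suc r) = begin
        andBit (eqBit (count (nth c r)) s) (ltBit (count (nth c r ∸ d)) s)
          ≡⟨ cong₂ (λ a b → andBit (eqBit a s) (ltBit b s)) (count-correct (nth c r)) (count-correct (nth c r ∸ d)) ⟩
        andBit (eqBit (childrenBelow σ (nth c r)) s) (ltBit (childrenBelow σ (nth c r ∸ d)) s)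
          ≡⟨ cong (λ n → andBit (eqBit (childrenBelow σ n) s) (ltBit (childrenBelow σ (n ∸ d)) s)) (nth-code ρ r) ⟩
        andBit (eqBit (childrenBelow σ n) s) (ltBit (childrenBelow σ (n ∸ d)) s)
          ≡⟨ cong₂ andBit (eqBit-correct (childrenBelow σ n) s) (ltBit-correct (childrenBelow σ (n ∸ d)) s) ⟩
        andBit (bit (childrenBelow σ n ≡ᵇ s)) (bit (childrenBelow σ (n ∸ d) <ᵇ s))
          ≡⟨ andBit-correct (childrenBelow σ n ≡ᵇ s) (childrenBelow σ (n ∸ d) <ᵇ s) ⟩
        bit (isNew σ n) ∎
      where
      open ≡-Reasoning
      c = code ρ
      σ = segment (entry ρ) 0 r
      n = entry ρ r
      count : ℕ → ℕ
      count x = childrenBelowCode x c r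
      count-correct : ∀ x → count x ≡ childrenBelow σ x
      count-correct x = childrenBelowCode-correct x ρ r

    widenCode : ℕ → ℕ
    widenCode c = ifZero (tCode c) (isNewAtCode c (lastNonzeroCode c)) 1

    c-widenCode : Computable 1 (fun₁ widenCode)
    c-widenCode = c-cong (λ { (c ∷ []) → refl })
      (c-compose₃ c-ifZero c-tCode (c-compose₂ c-isNewAtCode (c-proj (# 0)) c-lastNonzeroCode) (c-const 1))

    widenCode-correct : ∀ ρ → widenCode (code ρ) ≡ bit (widen ρ)
    widenCode-correct ρ = begin
        ifZero (tCode (code ρ)) (isNewAtCode (code ρ) (lastNonzeroCode (code ρ))) 1
          ≡⟨ cong₂ (λ b q → ifZero b (isNewAtCode (code ρ) q) 1) (tCode-code ρ) (lastNonzero-code ρ) ⟩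
        ifZero (bit (t ρ)) (isNewAtCode (code ρ) (lastNonzero ρ)) 1
          ≡⟨ by-cases (t ρ) ⟩
        bit (widen ρ) ∎
      where
      open ≡-Reasoning
      by-cases : ∀ b → ifZero (bit b) (isNewAtCode (code ρ) (lastNonzero ρ)) 1 ≡ bit (b ∨ added ρ)
      by-cases true  = refl
      by-cases false = isNewAtCode-correct ρ (lastNonzero ρ)

    widen-computable : ComputableSet widen
    widen-computable = proj₁ c-widenCode , λ σ →
      subst (noOracle ⊢ proj₁ c-widenCode [ code σ ∷ [] ]⇓_) (widenCode-correct σ) (proj₂ c-widenCode (code σ ∷ []))

lemma3p7 : ∀ (k s : ℕ) → 2 ≤ s → s ≤ k → ∀ (f : ℕ → ℕ) → DegreeGBS k f → DegreeGBS s f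
lemma3p7 k s 2≤s s≤k f (g , g≤f , g-survives) = g , g≤f , λ t isTree branching computable path →
  let open Widening t s (k ∸ s) in
  g-survives widen (widen-tree 2≤s isTree branching)
             (widen-branching 2≤s isTree branching k (m+[n∸m]≡n s≤k))
             (widen-computable computable) (widen-path g path)
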